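{- Every labelled transition matrix of a DOAG is a variation matrix. Furthermore, let $A = (a_{i,j})_{1 \le i,j \le n}$ be a variation matrix and for each $j \in \{1,\dots,n\}$ let $b_j$ be the largest $i \le n$ such that $a_{i,j} > 0$ if such an index exists, and $b_j = 0$ otherwise. Then $A$ is the labelled transition matrix of some DOAG if and only if both of the following hold: (i) the sequence $j \mapsto b_j$ is weakly increasing; (ii) whenever $b_j = b_{j+1} \geq 1$, we have $a_{b_j,j} < a_{b_j,j+1}$.
   Context: A directed ordered acyclic graph (DOAG) is a tuple $(V, E, (\prec_v)_{v \in V \cup \{\emptyset\}})$ where $V$ is a finite set of vertices, $E \subseteq V \times V$ is a set of edges such that $(V,E)$ is acyclic, for each $v \in V$, $\prec_v$ is a total order on the outgoing edges of $v$, and $\prec_\emptyset$ is a total order on the sources (vertices with no incoming edge). Two DOAGs are equal if there is a bijection of vertex sets preserving edges and all orders. Decomposition labelling: given a DOAG with $n$ vertices, repeatedly remove the smallest source (for the current source order) together with its outgoing edges; the sources newly uncovered by this removal are declared larger than all remaining previous sources, and are ordered among themselves in the order in which they appear as children of the removed vertex (w.r.t. its out-edge order). Labelling the vertices $1,\dots,n$ in the order they are removed gives a canonical labelling. The labelled transition matrix of the DOAG is $(a_{i,j})_{1\le i,j\le n}$ where $a_{i,j} = k > 0$ if there is an edge from vertex $i$ to vertex $j$ and it is the $k$-th outgoing edge of $i$, and $a_{i,j} = 0$ otherwise. A variation (of size $\ell$) is a sequence of $\ell$ non-negative integers in which each positive integer appears at most once and, if $0<i<j$ and $j$ appears, then $i$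 appears. A variation matrix of size $n$ is an integer matrix $(a_{i,j})_{1\le i,j\le n}$ that is strictly upper triangular and such that for each $1 \le i \le n-1$ the sub-row $(a_{i,j})_{i<j\le n}$ is a variation. -}

module Defs where

open import Data.Nat using (ℕ; zero; suc; _⊔_; _<_; _≤_; _<ᵇ_)
open import Data.Nat.Properties using (<-cmp)
open import Data.Fin using (Fin; toℕ; _≟_)
open import Data.Bool using (Bool; true; false; if_then_else_; _∨_; not)
open import Data.List using (List; []; _∷_; _++_; map; foldr; filterᵇ; allFin)
open import Data.Bool.ListAction using (all; any)
open import Data.List.Membership.Propositional using (_∈_)
open import Data.List.Relation.Unary.Unique.Propositional using (Unique)
open import Data.Maybe using (Maybe; just; nothing; fromMaybe)
open import Data.Product using (Σ; _×_)
open import Relation.Nullary using (¬_)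
open import Relation.Nullary.Decidable using (⌊_⌋)
open import Relation.Binary.PropositionalEquality using (_≡_)
open import Relation.Binary.Construct.Closure.Transitive using (TransClosure)
open import Function.Bundles using (_⇔_)

-- DOAGs on the vertex set Fin n.
-- children v : the outgoing edges of v, listed in the order ≺_v
--   (an edge v → c is present iff c ∈ children v; no repetitions since
--   E is a set of pairs).
-- srcOrder   : the sources, listed in the order ≺_∅.

record DOAG (n : ℕ) : Set where
  field
    children        : Fin n → List (Fin n)
    children-unique : ∀ v → Unique (children v)
    acyclic         : ∀ v → ¬ TransClosure (λ u w → w ∈ children u) v v
    srcOrder        : List (Fin n)
    srcOrder-unique : Unique srcOrder
    srcOrder-spec   : ∀ v → (v ∈ srcOrder) ⇔ (∀ u → ¬ (v ∈ children u))

open DOAG public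

_==_ : ∀ {n} → Fin n → Fin n → Bool
x == y = ⌊ x ≟ y ⌋

elem : ∀ {n} → Fin n → List (Fin n) → Bool
elem x xs = any (λ y → x == y) xs

module _ {n : ℕ} (D : DOAG n) where

  allParentsIn : List (Fin n) → Fin n → Bool
  allParentsIn rem c = all (λ u → not (elem c (children D u)) ∨ elem u rem) (allFin n)

  -- One step: remove the smallest source v (head of the queue); the newly
  -- uncovered sources are the children of v (in the order ≺_v) all of whose
  -- parents are now removed, and are appended after the remaining sources.
  -- The first argument is fuel (n steps suffice since D is acyclic).
  run : ℕ → List (Fin n) → List (Fin n) → List (Fin n)
  run zero    rem q       = []
  run (suc k) rem []      = []
  run (suc k) rem (v ∷ q) =
    v ∷ run k (v ∷ rem) (q ++ filterᵇ (allParentsIn (v ∷ rem)) (children D v))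

  removalOrder : List (Fin n)
  removalOrder = run n [] (srcOrder D)

nth : {A : Set} → List A → ℕ → Maybe A
nth []       _       = nothing
nth (x ∷ xs) zero    = just x
nth (x ∷ xs) (suc k) = nth xs k

-- the vertex receiving label (toℕ i + 1); the fallback is never used for a
-- DOAG since the removal order lists all n vertices.
vertexWithLabel : ∀ {n} → DOAG n → Fin n → Fin n
vertexWithLabel D i = fromMaybe i (nth (removalOrder D) (toℕ i))

-- 1-based position of x in xs, 0 if absent
pos : ∀ {n} → Fin n → List (Fin n) → ℕ
pos x [] = 0
pos x (y ∷ ys) with x == y
... | true  = 1
... | false with pos x ys
...   | zero  = 0
...   | suc k = suc (suc k)

Matrix : ℕ → Set
Matrix n = Fin n → Fin n → ℕ

-- Labelled transition matrix (indices 0..n-1 stand for labels 1..n):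
-- entry (i,j) is k if the vertex labelled j is the k-th child of the
-- vertex labelled i, and 0 otherwise.
ltm : ∀ {n} → DOAG n → Matrix n
ltm D i j = pos (vertexWithLabel D j) (children D (vertexWithLabel D i))

IsLTM : ∀ {n} → Matrix n → Set
IsLTM {n} A = Σ (DOAG n) λ D → ∀ i j → ltm D i j ≡ A i j

IsVariation : List ℕ → Set
IsVariation xs =
  (∀ k p q → 0 < k → nth xs p ≡ just k → nth xs q ≡ just k → p ≡ q) ×
  (∀ i j → 0 < i → i < j → j ∈ xs → i ∈ xs)

subRow : ∀ {n} → Matrix n → Fin n → List ℕ
subRow {n} A i = map (A i) (filterᵇ (λ j → toℕ i <ᵇ toℕ j) (allFin n))

IsVariationMatrix : ∀ {n} → Matrix n → Set
IsVariationMatrix A =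
  (∀ i j → toℕ j ≤ toℕ i → A i j ≡ 0) × (∀ i → IsVariation (subRow A i))

-- b_j : largest (1-based) row index i with a_{i,j} > 0, or 0 if none.
b : ∀ {n} → Matrix n → Fin n → ℕ
b {n} A j = foldr _⊔_ 0 (map (λ i → if 0 <ᵇ A i j then suc (toℕ i) else 0) (allFin n))

Cond1 : ∀ {n} → Matrix n → Set
Cond1 A = ∀ j k → toℕ j ≤ toℕ k → b A j ≤ b A k

-- (ii) b_j = b_{j+1} ≥ 1  ⇒  a_{b_j, j} < a_{b_j, j+1}
-- (row index i : Fin n corresponds to label toℕ i + 1 = b_j)
Cond2 : ∀ {n} → Matrix n → Set
Cond2 A = ∀ i j j' → toℕ j' ≡ suc (toℕ j) →
  b A j ≡ suc (toℕ i) → b A j' ≡ suc (toℕ i) → A i j < A i j'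

-- The decomposition removes a vertex only after all its parents, so parents get smaller labels and
-- row i of the matrix lists the out-edge indices 1, …, k of vertex i once each: a variation matrix.
-- Call the level of a vertex one plus the label of its last parent (0 for a source); this is b_j.
-- The queue is always sorted lexicographically by level and then, within a level, by the out-edge
-- order of that last parent (or by the source order at level 0); read along the labels this gives
-- exactly (i) and (ii).
-- Conversely, a variation matrix is the ordered graph whose vertex i has its out-edges to the columns
-- of the positive entries of row i, ordered by value, with the zero columns as sources in increasing
-- order. Under (i) and (ii) the same lexicographic order is the natural order of the columns, and a
-- strong induction shows that the decomposition gives every vertex its own index as label.

module Submission where

open import Defs
open import Data.Nat using (ℕ; zero; suc; _+_; _⊔_; _<_; _≤_; _<ᵇ_; _≡ᵇ_; z≤n; s≤s; _<?_) renaming (_≟_ to _≟ℕ_)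
open import Data.Nat.Properties hiding (_≟_)
open import Data.Fin using (Fin; toℕ; fromℕ<; _≟_)
open import Data.Fin.Properties using (toℕ-injective; toℕ-fromℕ<; toℕ<n; any?)
open import Data.Bool using (Bool; true; false; not; _∨_; T; T?; if_then_else_)
open import Data.Bool.Properties using (T-∨; T-not-≡)
open import Data.List using (List; []; _∷_; _++_; _ʳ++_; map; foldr; filter; filterᵇ; find; allFin; length; applyUpTo; mapMaybe)
open import Data.List.Properties using (map-cong; length-tabulate)
open import Data.List.Relation.Unary.All as All using (All; []; _∷_)
open import Data.List.Relation.Unary.All.Properties using (all⁺; all⁻)
open import Data.List.Relation.Unary.Any as Any using (Any; here; there)
open import Data.List.Relation.Unary.Any.Properties using (any⁺; any⁻)
open import Data.List.Relation.Unary.AllPairs as AllPairs using (AllPairs; []; _∷_)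
import Data.List.Relation.Unary.AllPairs.Properties as AllPairsₚ
open import Data.List.Membership.Propositional using (_∈_; _∉_)
open import Data.List.Membership.Propositional.Properties
open import Data.List.Relation.Unary.Unique.Propositional using (Unique)
import Data.List.Relation.Unary.Unique.Propositional.Properties as Uniqueₚ
open import Data.Maybe using (Maybe; just)
open import Data.Maybe.Properties using (just-injective)
open import Data.Product using (∃; _×_; _,_; proj₁; proj₂)
open import Data.Sum using (_⊎_; inj₁; inj₂)
open import Data.Empty using (⊥; ⊥-elim)
open import Function using (_∘_; case_of_)
open import Function.Bundles using (_⇔_; mk⇔; Equivalence)
open import Relation.Nullary using (¬_; ¬?; Dec; yes; no)
open import Relation.Nullary.Decidable using (toWitness; fromWitness; _×-dec_; decidable-stable)
open import Relation.Binary.PropositionalEquality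
open import Relation.Binary.Construct.Closure.Transitive using (TransClosure; [_]; _∷_)
open import Relation.Binary.Definitions using (tri<; tri≈; tri>)

private
  variable
    A : Set
    n : ℕ

∈-filterᵇ⁺ : ∀ (p : A → Bool) {x xs} → x ∈ xs → T (p x) → x ∈ filterᵇ p xs
∈-filterᵇ⁺ p = ∈-filter⁺ (T? ∘ p)

∈-filterᵇ⁻ : ∀ (p : A → Bool) xs {x} → x ∈ filterᵇ p xs → x ∈ xs × T (p x)
∈-filterᵇ⁻ p _ = ∈-filter⁻ (T? ∘ p)

elem⁺ : {x : Fin n} {xs : List (Fin n)} → x ∈ xs → T (elem x xs)
elem⁺ m = any⁺ _ (Any.map fromWitness m)

elem⁻ : {x : Fin n} (xs : List (Fin n)) → T (elem x xs) → x ∈ xs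
elem⁻ xs t = Any.map toWitness (any⁻ _ xs t)

elem-∉ : {x : Fin n} {xs : List (Fin n)} → x ∉ xs → elem x xs ≡ false
elem-∉ {x = x} {xs} x∉ with elem x xs in eq
... | true  = ⊥-elim (x∉ (elem⁻ xs (subst T (sym eq) _)))
... | false = refl

==-refl : (x : Fin n) → (x == x) ≡ true
==-refl x with x ≟ x
... | yes _  = refl
... | no x≢x = ⊥-elim (x≢x refl)

==-≢ : {x y : Fin n} → x ≢ y → (x == y) ≡ false
==-≢ {x = x} {y} x≢y with x ≟ y
... | yes x≡y = ⊥-elim (x≢y x≡y)
... | no  _   = refl

nth⇒∈ : ∀ {x : A} xs p → nth xs p ≡ just x → x ∈ xs
nth⇒∈ (y ∷ ys) zero    refl = here refl
nth⇒∈ (y ∷ ys) (suc p) eq   = there (nth⇒∈ ys p eq)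

nth⇒< : ∀ {x : A} xs p → nth xs p ≡ just x → p < length xs
nth⇒< (y ∷ ys) zero    _  = s≤s z≤n
nth⇒< (y ∷ ys) (suc p) eq = s≤s (nth⇒< ys p eq)

∈⇒nth : ∀ {x : A} {xs} → x ∈ xs → ∃ λ p → nth xs p ≡ just x
∈⇒nth (here refl) = 0 , refl
∈⇒nth (there m)   = let p , eq = ∈⇒nth m in suc p , eq

<⇒nth : ∀ (xs : List A) p → p < length xs → ∃ λ x → nth xs p ≡ just x
<⇒nth (y ∷ ys) zero    _         = y , refl
<⇒nth (y ∷ ys) (suc p) (s≤s p<) = <⇒nth ys p p<

nth-map⁺ : ∀ {B : Set} (f : A → B) xs p {x} → nth xs p ≡ just x → nth (map f xs) p ≡ just (f x)
nth-map⁺ f (x ∷ xs) zero    refl = refl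
nth-map⁺ f (x ∷ xs) (suc p) eq   = nth-map⁺ f xs p eq

nth-map⁻ : ∀ {B : Set} (f : A → B) xs p {y} → nth (map f xs) p ≡ just y →
           ∃ λ x → nth xs p ≡ just x × f x ≡ y
nth-map⁻ f (x ∷ xs) zero    refl = x , refl , refl
nth-map⁻ f (x ∷ xs) (suc p) eq   = nth-map⁻ f xs p eq

nth-injective : ∀ {x : A} {xs} → Unique xs → ∀ p q → nth xs p ≡ just x → nth xs q ≡ just x → p ≡ q
nth-injective {xs = y ∷ ys} _         zero    zero    _    _    = refl
nth-injective {xs = y ∷ ys} (y∉ ∷ _)  zero    (suc q) refl eq   = ⊥-elim (All.lookup y∉ (nth⇒∈ ys q eq) refl)
nth-injective {xs = y ∷ ys} (y∉ ∷ _)  (suc p) zero    eq   refl = ⊥-elim (All.lookup y∉ (nth⇒∈ ys p eq) refl)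
nth-injective {xs = y ∷ ys} (_ ∷ uys) (suc p) (suc q) eq₁  eq₂  = cong suc (nth-injective uys p q eq₁ eq₂)

AllPairs⇒nth< : ∀ {R : A → A → Set} {xs} → AllPairs R xs → ∀ p q {x y} →
                nth xs p ≡ just x → nth xs q ≡ just y → p < q → R x y
AllPairs⇒nth< {xs = z ∷ zs} (Rz ∷ _)  zero    (suc q) refl eq₂ _        = All.lookup Rz (nth⇒∈ zs q eq₂)
AllPairs⇒nth< {xs = z ∷ zs} (_ ∷ Rzs) (suc p) (suc q) eq₁  eq₂ (s≤s p<q) = AllPairs⇒nth< Rzs p q eq₁ eq₂ p<q

nth<⇒AllPairs : ∀ {R : A → A → Set} xs →
                (∀ p q {x y} → nth xs p ≡ just x → nth xs q ≡ just y → p < q → R x y) → AllPairs R xs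
nth<⇒AllPairs []       _ = []
nth<⇒AllPairs (z ∷ zs) R< =
  All.tabulate (λ m → let q , eq = ∈⇒nth m in R< 0 (suc q) refl eq (s≤s z≤n))
  ∷ nth<⇒AllPairs zs (λ p q eq₁ eq₂ p<q → R< (suc p) (suc q) eq₁ eq₂ (s≤s p<q))

AllPairs-weaken : ∀ {R S : A → A → Set} {xs} → AllPairs R xs →
                  (∀ {x y} → x ∈ xs → y ∈ xs → R x y → S x y) → AllPairs S xs
AllPairs-weaken []          _ = []
AllPairs-weaken (Rx ∷ Rxs) R⇒S =
  All.tabulate (λ m → R⇒S (here refl) (there m) (All.lookup Rx m))
  ∷ AllPairs-weaken Rxs (λ mx my → R⇒S (there mx) (there my))

nth-ʳ++ : ∀ (xs ys : List A) p → nth (xs ʳ++ ys) (length xs + p) ≡ nth ys p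
nth-ʳ++ []       ys p = refl
nth-ʳ++ (x ∷ xs) ys p rewrite sym (+-suc (length xs) p) = nth-ʳ++ xs (x ∷ ys) (suc p)

nth-ʳ++-length : ∀ (xs : List A) y ys → nth (xs ʳ++ y ∷ ys) (length xs) ≡ just y
nth-ʳ++-length xs y ys = trans (cong (nth (xs ʳ++ y ∷ ys)) (sym (+-identityʳ _))) (nth-ʳ++ xs (y ∷ ys) 0)

∈⇒nth-ʳ++ : ∀ {x : A} xs ys → x ∈ xs → ∃ λ p → p < length xs × nth (xs ʳ++ ys) p ≡ just x
∈⇒nth-ʳ++ (x ∷ xs) ys (here refl) = length xs , ≤-refl , nth-ʳ++-length xs x ys
∈⇒nth-ʳ++ (y ∷ xs) ys (there m) =
  let p , p< , eq = ∈⇒nth-ʳ++ xs (y ∷ ys) m in p , m<n⇒m<1+n p< , eq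

nth-applyUpTo : ∀ (f : ℕ → A) {m} t → t < m → nth (applyUpTo f m) t ≡ just (f t)
nth-applyUpTo f {suc m} zero    _         = refl
nth-applyUpTo f {suc m} (suc t) (s≤s t<m) = nth-applyUpTo (f ∘ suc) t t<m

find-complete : ∀ {P : A → Set} (P? : ∀ x → Dec (P x)) {x xs} → x ∈ xs → P x →
                ∃ λ y → find P? xs ≡ just y × P y
find-complete P? {xs = y ∷ ys} x∈ Px with P? y | x∈
... | yes Py | _          = y , refl , Py
... | no ¬Py | here refl  = ⊥-elim (¬Py Px)
... | no _   | there x∈′ = find-complete P? x∈′ Px

map-mapMaybe : ∀ {B : Set} (f : A → B) (g : B → Maybe A) ks →
               (∀ {k} → k ∈ ks → ∃ λ x → g k ≡ just x × f x ≡ k) → map f (mapMaybe g ks) ≡ ks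
map-mapMaybe f g []       _       = refl
map-mapMaybe f g (k ∷ ks) section with g k | section (here refl)
... | just x | _ , refl , refl = cong (f x ∷_) (map-mapMaybe f g ks (section ∘ there))

pos-∉ : {x : Fin n} (xs : List (Fin n)) → x ∉ xs → pos x xs ≡ 0
pos-∉ []               _  = refl
pos-∉ {x = x} (y ∷ ys) x∉ with x ≟ y
... | yes x≡y = ⊥-elim (x∉ (here x≡y))
... | no  _   rewrite pos-∉ ys (x∉ ∘ there) = refl

∈⇒pos≡suc : {x : Fin n} (xs : List (Fin n)) → x ∈ xs → ∃ λ p → pos x xs ≡ suc p × nth xs p ≡ just x
∈⇒pos≡suc {x = x} (y ∷ ys) m with x ≟ y | m
... | yes refl | _        = 0 , refl , refl
... | no  x≢y  | here x≡y = ⊥-elim (x≢y x≡y)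
... | no  _    | there m′ with pos x ys | ∈⇒pos≡suc ys m′
...   | _ | p , refl , eq = suc p , refl , eq

pos>0⇒∈ : {x : Fin n} (xs : List (Fin n)) → 0 < pos x xs → x ∈ xs
pos>0⇒∈ {x = x} (y ∷ ys) 0<pos with x ≟ y
... | yes x≡y = here x≡y
... | no  _ with pos x ys in eq
...   | suc _ = there (pos>0⇒∈ ys (subst (0 <_) (sym eq) (s≤s z≤n)))

nth⇒pos≡suc : {x : Fin n} {xs : List (Fin n)} → Unique xs → ∀ p → nth xs p ≡ just x → pos x xs ≡ suc p
nth⇒pos≡suc {xs = xs} uxs p eq with ∈⇒pos≡suc xs (nth⇒∈ xs p eq)
... | q , pos≡ , eq′ = trans pos≡ (cong suc (nth-injective uxs q p eq′ eq))

pos-injective : {x y : Fin n} (xs : List (Fin n)) → 0 < pos x xs → pos x xs ≡ pos y xs → x ≡ y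
pos-injective xs 0<pos pos≡ with ∈⇒pos≡suc xs (pos>0⇒∈ xs 0<pos)
... | p , x-at , x-nth with ∈⇒pos≡suc xs (pos>0⇒∈ xs (subst (0 <_) pos≡ 0<pos))
...   | q , y-at , y-nth with trans (sym x-at) (trans pos≡ y-at)
...     | refl = just-injective (trans (sym x-nth) y-nth)

Unique⇒AllPairs-pos< : (xs : List (Fin n)) → Unique xs → AllPairs (λ x y → pos x xs < pos y xs) xs
Unique⇒AllPairs-pos< xs uxs = nth<⇒AllPairs xs (λ p q eq₁ eq₂ p<q →
  subst₂ _<_ (sym (nth⇒pos≡suc uxs p eq₁)) (sym (nth⇒pos≡suc uxs q eq₂)) (s≤s p<q))

AllPairs⇒pos< : ∀ {R : Fin n → Fin n → Set} {xs} → AllPairs R xs → ∀ {x y} → x ∈ xs → y ∈ xs →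
                pos x xs < pos y xs → R x y
AllPairs⇒pos< {xs = xs} Rxs mx my pos< with ∈⇒pos≡suc xs mx | ∈⇒pos≡suc xs my
... | p , x-at , x-nth | q , y-at , y-nth =
  AllPairs⇒nth< Rxs p q x-nth y-nth (≤-pred (subst₂ _<_ x-at y-at pos<))

pos-downward : {x : Fin n} {xs : List (Fin n)} → Unique xs → ∀ k → 0 < k → k < pos x xs →
               ∃ λ y → pos y xs ≡ k
pos-downward {xs = xs} uxs (suc k) _ k<pos with ∈⇒pos≡suc xs (pos>0⇒∈ xs (<-trans (s≤s z≤n) k<pos))
... | p , pos≡ , x-at with <⇒nth xs k (<-trans (≤-pred (subst (suc k <_) pos≡ k<pos)) (nth⇒< xs p x-at))
...   | y , y-at = y , nth⇒pos≡suc uxs k y-at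

enumeration-unique : ∀ {f : Fin n → ℕ} {xs} m → map f xs ≡ applyUpTo suc m → Unique xs
enumeration-unique m image =
  Uniqueₚ.map⁻ (subst Unique (sym image) (Uniqueₚ.applyUpTo⁺₁ suc m λ i<j _ → <⇒≢ i<j ∘ suc-injective))

pos-enumeration : ∀ (f : Fin n → ℕ) {xs} m → map f xs ≡ applyUpTo suc m →
                  (∀ {x y} → 0 < f x → f x ≡ f y → x ≡ y) → (∀ x → f x ≤ m) → ∀ x → pos x xs ≡ f x
pos-enumeration f {xs} m image injective bounded x with f x in fx≡
... | zero  = pos-∉ xs λ x∈ → case ∈-applyUpTo⁻ suc (subst (f x ∈_) image (∈-map⁺ f x∈)) of λ where
                (_ , _ , fx≡suc) → 0≢1+n (trans (sym fx≡) fx≡suc)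
... | suc t with nth-map⁻ f xs t (trans (cong (λ ys → nth ys t) image)
                                        (nth-applyUpTo suc t (subst (_≤ m) fx≡ (bounded x))))
...   | y , y-at , fy≡ = nth⇒pos≡suc (enumeration-unique m image) t (subst (λ z → nth xs t ≡ just z) y≡x y-at)
  where
  y≡x : y ≡ x
  y≡x = injective (subst (0 <_) (sym fy≡) (s≤s z≤n)) (trans fy≡ (sym fx≡))

filterᵇ-cong : ∀ (p q : A → Bool) xs → (∀ {x} → x ∈ xs → p x ≡ q x) → filterᵇ p xs ≡ filterᵇ q xs
filterᵇ-cong p q []       _   = refl
filterᵇ-cong p q (x ∷ xs) p≗q with p x | q x | p≗q (here refl)
... | true  | true  | refl = cong (x ∷_) (filterᵇ-cong p q xs (p≗q ∘ there))
... | false | false | refl = filterᵇ-cong p q xs (p≗q ∘ there)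

length-filterᵇ-drop : ∀ (p q : A → Bool) {v} xs → Unique xs → v ∈ xs → p v ≡ true → q v ≡ false →
                      (∀ {x} → x ≢ v → p x ≡ q x) → length (filterᵇ p xs) ≡ suc (length (filterᵇ q xs))
length-filterᵇ-drop p q (x ∷ xs) (x∉ ∷ uxs) (here refl) pv qv p≗q rewrite pv | qv =
  cong (suc ∘ length) (filterᵇ-cong p q xs (λ m → p≗q (λ where refl → All.lookup x∉ m refl)))
length-filterᵇ-drop p q (x ∷ xs) (x∉ ∷ uxs) (there m) pv qv p≗q
  with p x | q x | p≗q {x} (λ where refl → All.lookup x∉ m refl)
... | true  | true  | refl = cong suc (length-filterᵇ-drop p q xs uxs m pv qv p≗q)
... | false | false | refl = length-filterᵇ-drop p q xs uxs m pv qv p≗q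

outside : List (Fin n) → List (Fin n)
outside {n} xs = filterᵇ (λ x → not (elem x xs)) (allFin n)

∈-outside⁺ : {x : Fin n} {xs : List (Fin n)} → x ∉ xs → x ∈ outside xs
∈-outside⁺ x∉ = ∈-filterᵇ⁺ _ (∈-allFin _) (Equivalence.from T-not-≡ (elem-∉ x∉))

∈-outside⁻ : {x : Fin n} {xs : List (Fin n)} → x ∈ outside xs → x ∉ xs
∈-outside⁻ {n} {xs = xs} m x∈ =
  subst T (Equivalence.to T-not-≡ (proj₂ (∈-filterᵇ⁻ _ (allFin n) m))) (elem⁺ x∈)

length-outside-[] : length (outside {n} []) ≡ n
length-outside-[] {n} = trans (cong length (filter-true (allFin n))) (length-tabulate (λ i → i))
  where
  filter-true : ∀ (xs : List A) → filterᵇ (λ _ → true) xs ≡ xs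
  filter-true []       = refl
  filter-true (x ∷ xs) = cong (x ∷_) (filter-true xs)

length-outside-∷ : {v : Fin n} (xs : List (Fin n)) → v ∉ xs →
                   length (outside xs) ≡ suc (length (outside (v ∷ xs)))
length-outside-∷ {n} {v} xs v∉ =
  length-filterᵇ-drop _ _ (allFin n) (Uniqueₚ.allFin⁺ n) (∈-allFin v)
    (cong not (elem-∉ v∉)) (cong (λ b → not (b ∨ elem v xs)) (==-refl v))
    (λ x≢v → cong (λ b → not (b ∨ elem _ xs)) (sym (==-≢ x≢v)))

module _ {E : Fin n → Fin n → Set} (E? : ∀ u w → Dec (E u w)) (acyclic : ∀ v → ¬ TransClosure E v v)
         {S : Fin n → Set} (S? : ∀ u → Dec (S u)) where

  private
    _◅_ : ∀ {u h y} → E u h → h ≡ y ⊎ TransClosure E h y → TransClosure E u y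
    Euh ◅ inj₁ refl = [ Euh ]
    Euh ◅ inj₂ h⁺y  = Euh ∷ h⁺y

    descend : ∀ k h path → k ≡ length (outside path) → S h →
              (∀ {y} → y ∈ path → h ≡ y ⊎ TransClosure E h y) →
              ∃ λ w → S w × (∀ u → E u w → ¬ S u)
    descend k h path k≡ Sh reach with any? (λ u → S? u ×-dec E? u h)
    ... | no ¬pred = h , Sh , λ u Euh Su → ¬pred (u , Su , Euh)
    ... | yes (u , Su , Euh) with Any.any? (u ≟_) path
    ...   | yes u∈ = ⊥-elim closes-cycle
      where
      closes-cycle : ⊥
      closes-cycle = acyclic u (Euh ◅ reach u∈)
    descend zero    h path k≡ Sh reach | yes (u , Su , Euh) | no u∉ =
      ⊥-elim (0≢1+n (trans k≡ (length-outside-∷ path u∉)))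
    descend (suc k) h path k≡ Sh reach | yes (u , Su , Euh) | no u∉ =
      descend k u (u ∷ path) (suc-injective (trans k≡ (length-outside-∷ path u∉))) Su reach′
      where
      reach′ : ∀ {y} → y ∈ u ∷ path → u ≡ y ⊎ TransClosure E u y
      reach′ (here refl) = inj₁ refl
      reach′ (there m) = inj₂ (Euh ◅ reach m)

  -- Walk backwards along E inside S: acyclicity forbids revisiting a vertex, so the walk stops.
  minimal : ∀ {x} → S x → ∃ λ w → S w × (∀ u → E u w → ¬ S u)
  minimal {x} Sx = descend _ x [] refl Sx (λ ())

PositiveInjectiveOn : (A → ℕ) → List A → Set
PositiveInjectiveOn f xs = ∀ {x y} → x ∈ xs → y ∈ xs → 0 < f x → f x ≡ f y → x ≡ y

DownwardClosedOn : (A → ℕ) → List A → Set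
DownwardClosedOn f xs = ∀ {x} k → x ∈ xs → 0 < k → k < f x → ∃ λ y → y ∈ xs × f y ≡ k

isVariation-map⁺ : ∀ (f : A → ℕ) {xs} → Unique xs →
                   PositiveInjectiveOn f xs → DownwardClosedOn f xs → IsVariation (map f xs)
isVariation-map⁺ f {xs} uxs inj down = distinct , downward
  where
  distinct : ∀ k p q → 0 < k → nth (map f xs) p ≡ just k → nth (map f xs) q ≡ just k → p ≡ q
  distinct k p q 0<k eq₁ eq₂ with nth-map⁻ f xs p eq₁ | nth-map⁻ f xs q eq₂
  ... | x , x-at , refl | y , y-at , fy≡fx with inj (nth⇒∈ xs p x-at) (nth⇒∈ xs q y-at) 0<k (sym fy≡fx)
  ...   | refl = nth-injective uxs p q x-at y-at
  downward : ∀ i j → 0 < i → i < j → j ∈ map f xs → i ∈ map f xs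
  downward i j 0<i i<j j∈ with ∈-map⁻ f j∈
  ... | x , x∈ , refl with down i x∈ 0<i i<j
  ...   | y , y∈ , refl = ∈-map⁺ f y∈

isVariation-map⁻ : ∀ (f : A → ℕ) {xs} → IsVariation (map f xs) →
                   PositiveInjectiveOn f xs × DownwardClosedOn f xs
isVariation-map⁻ f {xs} (distinct , downward) = inj , down
  where
  at : ∀ {x} → x ∈ xs → ∃ λ p → nth xs p ≡ just x × nth (map f xs) p ≡ just (f x)
  at x∈ = let p , eq = ∈⇒nth x∈ in p , eq , nth-map⁺ f xs p eq
  inj : PositiveInjectiveOn f xs
  inj x∈ y∈ 0<fx fx≡fy with at x∈ | at y∈
  ... | p , x-at , fx-at | q , y-at , fy-at with distinct _ p q 0<fx fx-at (trans fy-at (cong just (sym fx≡fy)))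
  ...   | refl = just-injective (trans (sym x-at) y-at)
  down : DownwardClosedOn f xs
  down k x∈ 0<k k<fx with ∈-map⁻ f (downward k _ 0<k k<fx (∈-map⁺ f x∈))
  ... | y , y∈ , refl = y , y∈ , refl

later : Fin n → List (Fin n)
later {n} i = filterᵇ (λ j → toℕ i <ᵇ toℕ j) (allFin n)

∈-later⁺ : ∀ {i j : Fin n} → toℕ i < toℕ j → j ∈ later i
∈-later⁺ i<j = ∈-filterᵇ⁺ _ (∈-allFin _) (<⇒<ᵇ i<j)

later-unique : ∀ (i : Fin n) → Unique (later i)
later-unique {n} i = Uniqueₚ.filter⁺ _ (Uniqueₚ.allFin⁺ n)

maximum : List ℕ → ℕ
maximum = foldr _⊔_ 0

≤-maximum : ∀ {x} xs → x ∈ xs → x ≤ maximum xs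
≤-maximum (y ∷ ys) (here refl) = m≤m⊔n y _
≤-maximum (y ∷ ys) (there m)   = ≤-trans (≤-maximum ys m) (m≤n⊔m y _)

maximum-attained : ∀ xs → maximum xs ≡ 0 ⊎ maximum xs ∈ xs
maximum-attained []       = inj₁ refl
maximum-attained (y ∷ ys) with ⊔-sel y (maximum ys) | maximum-attained ys
... | inj₁ eq | _        = inj₂ (here eq)
... | inj₂ eq | inj₁ eq′ = inj₁ (trans eq eq′)
... | inj₂ eq | inj₂ m   = inj₂ (there (subst (_∈ ys) (sym eq) m))

private
  rowIfNonzero : Matrix n → Fin n → Fin n → ℕ
  rowIfNonzero M j i = if 0 <ᵇ M i j then suc (toℕ i) else 0

entry>0⇒row<b : ∀ (M : Matrix n) {i j} → 0 < M i j → toℕ i < b M j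
entry>0⇒row<b {n} M {i} {j} 0<M =
  subst (_≤ b M j) (nonzero (<⇒<ᵇ 0<M)) (≤-maximum _ (∈-map⁺ (rowIfNonzero M j) (∈-allFin i)))
  where
  nonzero : T (0 <ᵇ M i j) → rowIfNonzero M j i ≡ suc (toℕ i)
  nonzero t with 0 <ᵇ M i j
  ... | true = refl

b-attained : ∀ (M : Matrix n) j → b M j ≡ 0 ⊎ ∃ λ i → b M j ≡ suc (toℕ i) × 0 < M i j
b-attained {n} M j with maximum-attained (map (rowIfNonzero M j) (allFin n))
... | inj₁ eq = inj₁ eq
... | inj₂ m with ∈-map⁻ (rowIfNonzero M j) m
...   | i , _ , eq with 0 <ᵇ M i j in nonzero
...     | true  = inj₂ (i , eq , <ᵇ⇒< 0 (M i j) (subst T (sym nonzero) _))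
...     | false = inj₁ eq

b≡0⇒entry≡0 : ∀ (M : Matrix n) {j} → b M j ≡ 0 → ∀ i → M i j ≡ 0
b≡0⇒entry≡0 M {j} b≡0 i with M i j in eq
... | zero  = refl
... | suc _ with subst (toℕ i <_) b≡0 (entry>0⇒row<b M (subst (0 <_) (sym eq) (s≤s z≤n)))
...   | ()

b-cong : ∀ (M M′ : Matrix n) {j j′} → (∀ i → M i j ≡ M′ i j′) → b M j ≡ b M′ j′
b-cong {n} M M′ M≗M′ =
  cong maximum (map-cong (λ i → cong (λ x → if 0 <ᵇ x then suc (toℕ i) else 0) (M≗M′ i)) (allFin n))

-- The decomposition of a DOAG

module Decomposition (D : DOAG n) where

  ParentsIn : List (Fin n) → Fin n → Set
  ParentsIn rem c = ∀ u → c ∈ children D u → u ∈ rem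

  allParentsIn⁻ : ∀ rem c → T (allParentsIn D rem c) → ParentsIn rem c
  allParentsIn⁻ rem c t u c∈ with Equivalence.to T-∨ (All.lookup (all⁺ _ (allFin n) t) (∈-allFin u))
  ... | inj₁ c∉ = ⊥-elim (subst T (Equivalence.to T-not-≡ c∉) (elem⁺ c∈))
  ... | inj₂ u∈ = elem⁻ rem u∈

  allParentsIn⁺ : ∀ rem c → ParentsIn rem c → T (allParentsIn D rem c)
  allParentsIn⁺ rem c parents = all⁻ _ (All.tabulate {xs = allFin n} λ {u} _ → or-removed u)
    where
    or-removed : ∀ u → T (not (elem c (children D u)) ∨ elem u rem)
    or-removed u with Any.any? (c ≟_) (children D u)
    ... | yes c∈ = Equivalence.from T-∨ (inj₂ (elem⁺ (parents u c∈)))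
    ... | no  c∉ = Equivalence.from T-∨ (inj₁ (Equivalence.from T-not-≡ (elem-∉ c∉)))

  uncovered : Fin n → List (Fin n) → List (Fin n)
  uncovered v rem = filterᵇ (allParentsIn D (v ∷ rem)) (children D v)

  ∈-uncovered⁻ : ∀ v rem {c} → c ∈ uncovered v rem → c ∈ children D v × ParentsIn (v ∷ rem) c
  ∈-uncovered⁻ v rem m with ∈-filterᵇ⁻ (allParentsIn D (v ∷ rem)) (children D v) m
  ... | c∈ , t = c∈ , allParentsIn⁻ (v ∷ rem) _ t

  ∈-uncovered⁺ : ∀ v rem {c} → c ∈ children D v → ParentsIn (v ∷ rem) c → c ∈ uncovered v rem
  ∈-uncovered⁺ v rem c∈ parents =
    ∈-filterᵇ⁺ (allParentsIn D (v ∷ rem)) c∈ (allParentsIn⁺ (v ∷ rem) _ parents)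

  uncovered-unique : ∀ v rem → Unique (uncovered v rem)
  uncovered-unique v rem = Uniqueₚ.filter⁺ _ (children-unique D v)

  -- rem lists the removed vertices, most recent first; q is the queue of current sources.
  record Invariant (rem q : List (Fin n)) : Set where
    field
      queue-unique   : Unique q
      queue-fresh    : ∀ {x} → x ∈ q → x ∉ rem
      queue-ready    : ∀ {x} → x ∈ q → ParentsIn rem x
      ready-queued   : ∀ {x} → x ∉ rem → ParentsIn rem x → x ∈ q
      removed-closed : ∀ {x} → x ∈ rem → ParentsIn rem x
  open Invariant

  invariant-start : Invariant [] (srcOrder D)
  invariant-start = record
    { queue-unique   = srcOrder-unique D
    ; queue-fresh    = λ _ ()
    ; queue-ready    = λ x∈ u c∈ → ⊥-elim (Equivalence.to (srcOrder-spec D _) x∈ u c∈)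
    ; ready-queued   = λ _ parents → Equivalence.from (srcOrder-spec D _) (λ u c∈ → no-parent (parents u c∈))
    ; removed-closed = λ ()
    }
    where
    no-parent : ∀ {u : Fin n} → u ∉ []
    no-parent ()

  invariant-step : ∀ {rem v q} → Invariant rem (v ∷ q) → Invariant (v ∷ rem) (q ++ uncovered v rem)
  invariant-step {rem} {v} {q} I = record
    { queue-unique   = Uniqueₚ.++⁺ (AllPairs.tail (queue-unique I)) (uncovered-unique v rem)
                         (λ (x∈q , x∈new) → new-∉q x∈new x∈q)
    ; queue-fresh    = fresh
    ; queue-ready    = ready
    ; ready-queued   = queued
    ; removed-closed = λ where
        (here refl) u c∈ → there (queue-ready I (here refl) u c∈)
        (there x∈)  u c∈ → there (removed-closed I x∈ u c∈)
    }
    where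
    v∉rem : v ∉ rem
    v∉rem = queue-fresh I (here refl)
    v∉q : v ∉ q
    v∉q x∈ = All.lookup (AllPairs.head (queue-unique I)) x∈ refl
    -- a child of v cannot already be ready, since its parent v was not removed yet
    new-∉q : ∀ {c} → c ∈ uncovered v rem → c ∉ q
    new-∉q c∈ c∈q = v∉rem (queue-ready I (there c∈q) v (proj₁ (∈-uncovered⁻ v rem c∈)))
    new-fresh : ∀ {c} → c ∈ uncovered v rem → c ∉ v ∷ rem
    new-fresh c∈ (here refl) = acyclic D v [ proj₁ (∈-uncovered⁻ v rem c∈) ]
    new-fresh c∈ (there c∈rem) = v∉rem (removed-closed I c∈rem v (proj₁ (∈-uncovered⁻ v rem c∈)))
    fresh : ∀ {x} → x ∈ q ++ uncovered v rem → x ∉ v ∷ rem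
    fresh x∈ with ∈-++⁻ q x∈
    ... | inj₁ x∈q = λ where
            (here refl)  → v∉q x∈q
            (there x∈r) → queue-fresh I (there x∈q) x∈r
    ... | inj₂ x∈new = new-fresh x∈new
    ready : ∀ {x} → x ∈ q ++ uncovered v rem → ParentsIn (v ∷ rem) x
    ready x∈ with ∈-++⁻ q x∈
    ... | inj₁ x∈q   = λ u c∈ → there (queue-ready I (there x∈q) u c∈)
    ... | inj₂ x∈new = proj₂ (∈-uncovered⁻ v rem x∈new)
    parents-in-rem : ∀ {x} → x ∉ children D v → ParentsIn (v ∷ rem) x → ParentsIn rem x
    parents-in-rem x∉children parents u c∈ with parents u c∈
    ... | here refl = ⊥-elim (x∉children c∈)
    ... | there u∈  = u∈
    queued : ∀ {x} → x ∉ v ∷ rem → ParentsIn (v ∷ rem) x → x ∈ q ++ uncovered v rem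
    queued {x} x∉ parents with Any.any? (x ≟_) (children D v)
    ... | yes x∈children = ∈-++⁺ʳ q (∈-uncovered⁺ v rem x∈children parents)
    ... | no  x∉children with ready-queued I (x∉ ∘ there) (parents-in-rem x∉children parents)
    ...   | here refl = ⊥-elim (x∉ (here refl))
    ...   | there x∈q = ∈-++⁺ˡ x∈q

  ready-exists : ∀ {rem x} → x ∉ rem → ∃ λ w → w ∉ rem × ParentsIn rem w
  ready-exists {rem} x∉ with minimal (λ u w → Any.any? (w ≟_) (children D u)) (acyclic D)
                                     (λ u → ¬? (Any.any? (u ≟_) rem)) x∉
  ... | w , w∉ , parents = w , w∉ , λ u c∈ → decidable-stable (Any.any? (u ≟_) rem) (parents u c∈)

  record Enumerates (rem O : List (Fin n)) : Set where
    field
      unique   : Unique O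
      fresh    : All (_∉ rem) O
      complete : ∀ {x} → x ∉ rem → x ∈ O
      length-O : length O ≡ length (outside rem)
  open Enumerates

  run-enumerates : ∀ k rem q → Invariant rem q → k ≡ length (outside rem) → Enumerates rem (run D k rem q)
  run-enumerates zero rem q I k≡ = record
    { unique = [] ; fresh = [] ; length-O = k≡
    ; complete = λ x∉ → ⊥-elim (none-outside (sym k≡) (∈-outside⁺ x∉)) }
    where
    none-outside : ∀ {x : Fin n} {xs} → length xs ≡ 0 → x ∉ xs
    none-outside {xs = []} _ ()
  run-enumerates (suc k) rem [] I k≡
    with x , x-at ← <⇒nth (outside rem) 0 (subst (0 <_) k≡ (s≤s z≤n))
    with w , w∉ , parents ← ready-exists (∈-outside⁻ (nth⇒∈ _ 0 x-at))
    with () ← ready-queued I w∉ parents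
  run-enumerates (suc k) rem (v ∷ q) I k≡ = record
    { unique   = All.tabulate (λ x∈ v≡x → All.lookup (fresh E) x∈ (here (sym v≡x))) ∷ unique E
    ; fresh    = v∉rem ∷ All.map (_∘ there) (fresh E)
    ; complete = λ {x} x∉ → case Any.any? (x ≟_) (v ∷ rem) of λ where
        (yes (here refl)) → here refl
        (yes (there x∈)) → ⊥-elim (x∉ x∈)
        (no x∉′)         → there (complete E x∉′)
    ; length-O = trans (cong suc (length-O E)) (sym (length-outside-∷ rem v∉rem))
    }
    where
    v∉rem = queue-fresh I (here refl)
    E = run-enumerates k (v ∷ rem) (q ++ uncovered v rem) (invariant-step I)
          (suc-injective (trans k≡ (length-outside-∷ rem v∉rem)))

  L : List (Fin n)
  L = removalOrder D

  private
    L-enumerates : Enumerates [] L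
    L-enumerates = run-enumerates n [] (srcOrder D) invariant-start (sym length-outside-[])

  L-unique : Unique L
  L-unique = unique L-enumerates

  L-length : length L ≡ n
  L-length = trans (length-O L-enumerates) length-outside-[]

  ∈-L : ∀ x → x ∈ L
  ∈-L x = complete L-enumerates (λ ())

  σ : Fin n → Fin n
  σ = vertexWithLabel D

  nth-σ : ∀ i → nth L (toℕ i) ≡ just (σ i)
  nth-σ i with _ , eq ← <⇒nth L (toℕ i) (subst (toℕ i <_) (sym L-length) (toℕ<n i)) rewrite eq = refl

  private
    index-of : ∀ v → ∃ λ p → p < n × nth L p ≡ just v
    index-of v = let p , eq = ∈⇒nth (∈-L v) in p , subst (p <_) L-length (nth⇒< L p eq) , eq

  σ⁻¹ : Fin n → Fin n
  σ⁻¹ v = fromℕ< (proj₁ (proj₂ (index-of v)))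

  nth-σ⁻¹ : ∀ v → nth L (toℕ (σ⁻¹ v)) ≡ just v
  nth-σ⁻¹ v = subst (λ p → nth L p ≡ just v) (sym (toℕ-fromℕ< _)) (proj₂ (proj₂ (index-of v)))

  nth⇒σ⁻¹ : ∀ {v} p → nth L p ≡ just v → toℕ (σ⁻¹ v) ≡ p
  nth⇒σ⁻¹ {v} p eq = nth-injective L-unique _ p (nth-σ⁻¹ v) eq

  σ-σ⁻¹ : ∀ v → σ (σ⁻¹ v) ≡ v
  σ-σ⁻¹ v = just-injective (trans (sym (nth-σ (σ⁻¹ v))) (nth-σ⁻¹ v))

  σ⁻¹-σ : ∀ i → σ⁻¹ (σ i) ≡ i
  σ⁻¹-σ i = toℕ-injective (nth⇒σ⁻¹ (toℕ i) (nth-σ i))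

  σ-injective : ∀ {i j} → σ i ≡ σ j → i ≡ j
  σ-injective {i} {j} eq = trans (sym (σ⁻¹-σ i)) (trans (cong σ⁻¹ eq) (σ⁻¹-σ j))

  ltm-σ⁻¹ : ∀ u c → ltm D (σ⁻¹ u) (σ⁻¹ c) ≡ pos c (children D u)
  ltm-σ⁻¹ u c rewrite σ-σ⁻¹ u | σ-σ⁻¹ c = refl

  ltm>0⇒child : ∀ i x → 0 < ltm D i (σ⁻¹ x) → x ∈ children D (σ i)
  ltm>0⇒child i x 0<a = pos>0⇒∈ (children D (σ i)) (subst (λ y → 0 < pos y (children D (σ i))) (σ-σ⁻¹ x) 0<a)

  level : Fin n → ℕ
  level y = b (ltm D) (σ⁻¹ y)

  SameLevelOrdered : Fin n → Fin n → Set
  SameLevelOrdered x y = (level x ≡ 0 → pos x (srcOrder D) < pos y (srcOrder D)) ×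
                         (∀ i → level x ≡ suc (toℕ i) → ltm D i (σ⁻¹ x) < ltm D i (σ⁻¹ y))

  Precedes : Fin n → Fin n → Set
  Precedes x y = level x < level y ⊎ (level x ≡ level y × SameLevelOrdered x y)

  ParentsEarlier : Fin n → Set
  ParentsEarlier y = ∀ u → y ∈ children D u → toℕ (σ⁻¹ u) < toℕ (σ⁻¹ y)

  record Splits (rem O : List (Fin n)) : Set where
    constructor splits
    field
      L≡ : L ≡ rem ʳ++ O

  splits-step : ∀ {rem v O} → Splits rem (v ∷ O) → Splits (v ∷ rem) O
  splits-step (splits L≡) = splits L≡

  σ⁻¹-removed : ∀ {rem O u} → Splits rem O → u ∈ rem → toℕ (σ⁻¹ u) < length rem
  σ⁻¹-removed {rem} {O} (splits L≡) u∈ with p , p< , eq ← ∈⇒nth-ʳ++ rem O u∈ =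
    subst (_< length rem) (sym (nth⇒σ⁻¹ p (trans (cong (λ xs → nth xs p) L≡) eq))) p<

  σ⁻¹-next : ∀ {rem v O} → Splits rem (v ∷ O) → toℕ (σ⁻¹ v) ≡ length rem
  σ⁻¹-next {rem} {v} {O} (splits L≡) =
    nth⇒σ⁻¹ _ (trans (cong (λ xs → nth xs (length rem)) L≡) (nth-ʳ++-length rem v O))

  level≤ : ∀ {rem O x} → Splits rem O → ParentsIn rem x → level x ≤ length rem
  level≤ {rem} {x = x} split parents with b-attained (ltm D) (σ⁻¹ x)
  ... | inj₁ eq             = subst (_≤ length rem) (sym eq) z≤n
  ... | inj₂ (i , eq , 0<a) = subst (_≤ length rem) (sym eq)
    (subst (λ j → toℕ j < length rem) (σ⁻¹-σ i) (σ⁻¹-removed split (parents (σ i) (ltm>0⇒child i x 0<a))))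

  level-uncovered : ∀ {rem v O c} → Splits rem (v ∷ O) → c ∈ uncovered v rem → level c ≡ suc (length rem)
  level-uncovered {rem} {v} {O} {c} split c∈ with c∈children , parents ← ∈-uncovered⁻ v rem c∈ =
    ≤-antisym (level≤ (splits-step split) parents)
              (subst (_< level c) (σ⁻¹-next split) (entry>0⇒row<b (ltm D) 0<a))
    where
    0<a : 0 < ltm D (σ⁻¹ v) (σ⁻¹ c)
    0<a = subst (0 <_) (sym (trans (ltm-σ⁻¹ v c) (proj₁ (proj₂ (∈⇒pos≡suc _ c∈children))))) (s≤s z≤n)

  level-source : ∀ {x} → x ∈ srcOrder D → level x ≡ 0
  level-source {x} x∈ with b-attained (ltm D) (σ⁻¹ x)
  ... | inj₁ eq            = eq
  ... | inj₂ (i , _ , 0<a) = ⊥-elim (Equivalence.to (srcOrder-spec D x) x∈ (σ i) (ltm>0⇒child i x 0<a))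

  sources-sorted : AllPairs Precedes (srcOrder D)
  sources-sorted = AllPairs-weaken (Unique⇒AllPairs-pos< (srcOrder D) (srcOrder-unique D)) λ x∈ y∈ pos< →
    inj₂ ( trans (level-source x∈) (sym (level-source y∈))
         , (λ _ → pos<)
         , (λ _ eq → ⊥-elim (0≢1+n (trans (sym (level-source x∈)) eq))) )

  uncovered-sorted : ∀ {rem v O} → Splits rem (v ∷ O) → AllPairs Precedes (uncovered v rem)
  uncovered-sorted {v = v} split =
    AllPairs-weaken (AllPairsₚ.filter⁺ _ (Unique⇒AllPairs-pos< (children D v) (children-unique D v)))
      λ {x} {y} x∈ y∈ pos< →
        inj₂ ( trans (level-uncovered split x∈) (sym (level-uncovered split y∈))
             , (λ eq → ⊥-elim (0≢1+n (trans (sym eq) (level-uncovered split x∈))))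
             , (λ i eq → subst (λ j → ltm D j (σ⁻¹ x) < ltm D j (σ⁻¹ y))
                           (toℕ-injective (trans (σ⁻¹-next split)
                                                 (suc-injective (trans (sym (level-uncovered split x∈)) eq))))
                           (subst₂ _<_ (sym (ltm-σ⁻¹ v x)) (sym (ltm-σ⁻¹ v y)) pos<)) )

  queue-step-sorted : ∀ {rem v q O} → Splits rem (v ∷ O) → Invariant rem (v ∷ q) →
                      AllPairs Precedes (v ∷ q) → AllPairs Precedes (q ++ uncovered v rem)
  queue-step-sorted split I sorted =
    AllPairsₚ.++⁺ (AllPairs.tail sorted) (uncovered-sorted split)
      (All.tabulate λ {x} x∈q → All.tabulate λ {y} y∈new →
        inj₁ (subst (level x <_) (sym (level-uncovered split y∈new))
                    (s≤s (level≤ split (queue-ready I (there x∈q))))))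

  record Sorted (rem q O : List (Fin n)) : Set where
    field
      precedes        : AllPairs Precedes O
      parents-earlier : All ParentsEarlier O
      queued-or-later : ∀ {y} → y ∈ O → y ∈ q ⊎ length rem < level y
  open Sorted

  run-sorted : ∀ k rem q → Splits rem (run D k rem q) → Invariant rem q → AllPairs Precedes q →
               Sorted rem q (run D k rem q)
  run-sorted zero    rem q       _  _ _ = record { precedes = [] ; parents-earlier = [] ; queued-or-later = λ () }
  run-sorted (suc k) rem []      _  _ _ = record { precedes = [] ; parents-earlier = [] ; queued-or-later = λ () }
  run-sorted (suc k) rem (v ∷ q) split I sorted = record
    { precedes        = All.tabulate v-first ∷ precedes S
    ; parents-earlier = v-parents-earlier ∷ parents-earlier S
    ; queued-or-later = λ where
        (here refl) → inj₁ (here refl)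
        (there y∈)  → case queued-or-later S y∈ of λ where
          (inj₂ later) → inj₂ (<-trans (n<1+n _) later)
          (inj₁ y∈′)   → case ∈-++⁻ q y∈′ of λ where
            (inj₁ y∈q)   → inj₁ (there y∈q)
            (inj₂ y∈new) → inj₂ (≤-reflexive (sym (level-uncovered split y∈new)))
    }
    where
    O = run D k (v ∷ rem) (q ++ uncovered v rem)
    S = run-sorted k (v ∷ rem) (q ++ uncovered v rem)
                   (splits-step split) (invariant-step I) (queue-step-sorted split I sorted)
    level-v : level v ≤ length rem
    level-v = level≤ split (queue-ready I (here refl))
    v-first : ∀ {y} → y ∈ O → Precedes v y
    v-first y∈ with queued-or-later S y∈
    ... | inj₂ later = inj₁ (≤-<-trans level-v (<-trans (n<1+n _) later))
    ... | inj₁ y∈′ with ∈-++⁻ q y∈′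
    ...   | inj₁ y∈q   = All.lookup (AllPairs.head sorted) y∈q
    ...   | inj₂ y∈new = inj₁ (subst (level v <_) (sym (level-uncovered split y∈new)) (s≤s level-v))
    v-parents-earlier : ParentsEarlier v
    v-parents-earlier u c∈ =
      subst (toℕ (σ⁻¹ u) <_) (sym (σ⁻¹-next split)) (σ⁻¹-removed split (queue-ready I (here refl) u c∈))

  private
    L-sorted : Sorted [] (srcOrder D) L
    L-sorted = run-sorted n [] (srcOrder D) (splits refl) invariant-start sources-sorted

  σ-precedes : ∀ {i j} → toℕ i < toℕ j → Precedes (σ i) (σ j)
  σ-precedes {i} {j} = AllPairs⇒nth< (precedes L-sorted) (toℕ i) (toℕ j) (nth-σ i) (nth-σ j)

  ltm>0⇒< : ∀ {i j} → 0 < ltm D i j → toℕ i < toℕ j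
  ltm>0⇒< {i} {j} 0<a =
    subst₂ (λ i′ j′ → toℕ i′ < toℕ j′) (σ⁻¹-σ i) (σ⁻¹-σ j)
      (All.lookup (parents-earlier L-sorted) (∈-L (σ j)) (σ i) (pos>0⇒∈ (children D (σ i)) 0<a))

  level-σ : ∀ j → level (σ j) ≡ b (ltm D) j
  level-σ j = cong (b (ltm D)) (σ⁻¹-σ j)

-- Labelled transition matrices

module _ (D : DOAG n) where
  open Decomposition D

  ltm-isVariationMatrix : IsVariationMatrix (ltm D)
  ltm-isVariationMatrix = upper , λ i → isVariation-map⁺ (ltm D i) (later-unique i) (injective i) (downward i)
    where
    upper : ∀ i j → toℕ j ≤ toℕ i → ltm D i j ≡ 0
    upper i j j≤i with ltm D i j in eq
    ... | zero  = refl
    ... | suc _ = ⊥-elim (<⇒≱ (ltm>0⇒< (subst (0 <_) (sym eq) (s≤s z≤n))) j≤i)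
    injective : ∀ i → PositiveInjectiveOn (ltm D i) (later i)
    injective i _ _ 0<a eq = σ-injective (pos-injective (children D (σ i)) 0<a eq)
    downward : ∀ i → DownwardClosedOn (ltm D i) (later i)
    downward i k _ 0<k k<a with y , pos≡k ← pos-downward (children-unique D (σ i)) k 0<k k<a =
      σ⁻¹ y , ∈-later⁺ (ltm>0⇒< 0<a′) , a≡k
      where
      a≡k : ltm D i (σ⁻¹ y) ≡ k
      a≡k = trans (cong (λ x → pos x (children D (σ i))) (σ-σ⁻¹ y)) pos≡k
      0<a′ : 0 < ltm D i (σ⁻¹ y)
      0<a′ = subst (0 <_) (sym a≡k) 0<k

  ltm-cond1 : Cond1 (ltm D)
  ltm-cond1 j k j≤k with m≤n⇒m<n∨m≡n j≤k
  ... | inj₂ eq rewrite toℕ-injective eq = ≤-refl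
  ... | inj₁ j<k = subst₂ _≤_ (level-σ j) (level-σ k) (level-mono (σ-precedes j<k))
    where
    level-mono : ∀ {x y} → Precedes x y → level x ≤ level y
    level-mono (inj₁ lt)       = <⇒≤ lt
    level-mono (inj₂ (eq , _)) = ≤-reflexive eq

  ltm-cond2 : Cond2 (ltm D)
  ltm-cond2 i j j′ j′≡ bj bj′ with σ-precedes (subst (toℕ j <_) (sym j′≡) ≤-refl)
  ... | inj₁ lt = ⊥-elim (<-irrefl (trans (trans (level-σ j) bj) (sym (trans (level-σ j′) bj′))) lt)
  ... | inj₂ (_ , _ , ordered) =
    subst₂ (λ x y → ltm D i x < ltm D i y) (σ⁻¹-σ j) (σ⁻¹-σ j′) (ordered i (trans (level-σ j) bj))

Cond1-cong : ∀ {M M′ : Matrix n} → (∀ i j → M i j ≡ M′ i j) → Cond1 M → Cond1 M′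
Cond1-cong {M = M} {M′} M≗M′ c1 j k j≤k =
  subst₂ _≤_ (b-cong M M′ (λ i → M≗M′ i j)) (b-cong M M′ (λ i → M≗M′ i k)) (c1 j k j≤k)

Cond2-cong : ∀ {M M′ : Matrix n} → (∀ i j → M i j ≡ M′ i j) → Cond2 M → Cond2 M′
Cond2-cong {M = M} {M′} M≗M′ c2 i j j′ j′≡ bj bj′ =
  subst₂ _<_ (M≗M′ i j) (M≗M′ i j′)
    (c2 i j j′ j′≡ (trans (b-cong M M′ (λ i → M≗M′ i j)) bj)
                   (trans (b-cong M M′ (λ i → M≗M′ i j′)) bj′))

isLTM⇒conditions : ∀ {A : Matrix n} → IsLTM A → Cond1 A × Cond2 A
isLTM⇒conditions (D , ltm≗A) = Cond1-cong ltm≗A (ltm-cond1 D) , Cond2-cong ltm≗A (ltm-cond2 D)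

-- Realising a variation matrix

module Construction (A : Matrix n) (isVM : IsVariationMatrix A) where

  entry>0⇒< : ∀ {i j} → 0 < A i j → toℕ i < toℕ j
  entry>0⇒< {i} {j} 0<a with toℕ i <? toℕ j
  ... | yes i<j = i<j
  ... | no  i≮j = ⊥-elim (<-irrefl refl (subst (0 <_) (proj₁ isVM i j (≮⇒≥ i≮j)) 0<a))

  row-injective : ∀ {i j j′} → 0 < A i j → A i j ≡ A i j′ → j ≡ j′
  row-injective 0<a eq = proj₁ (isVariation-map⁻ _ (proj₂ isVM _))
    (∈-later⁺ (entry>0⇒< 0<a)) (∈-later⁺ (entry>0⇒< (subst (0 <_) eq 0<a))) 0<a eq

  row-downward : ∀ {i j} k → 0 < k → k ≤ A i j → ∃ λ j′ → A i j′ ≡ k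
  row-downward {j = j} k 0<k k≤a with m≤n⇒m<n∨m≡n k≤a
  ... | inj₂ k≡a = j , sym k≡a
  ... | inj₁ k<a
    with proj₂ (isVariation-map⁻ _ (proj₂ isVM _)) k (∈-later⁺ (entry>0⇒< (<-trans 0<k k<a))) 0<k k<a
  ...   | j′ , _ , eq = j′ , eq

  rowMax : Fin n → ℕ
  rowMax i = maximum (map (A i) (allFin n))

  columnWith : Fin n → ℕ → Maybe (Fin n)
  columnWith i k = find (λ j → A i j ≟ℕ k) (allFin n)

  columnWith-complete : ∀ i {k} → k ∈ applyUpTo suc (rowMax i) →
                        ∃ λ j → columnWith i k ≡ just j × A i j ≡ k
  columnWith-complete i k∈ with t , t<max , refl ← ∈-applyUpTo⁻ suc k∈
                           with maximum-attained (map (A i) (allFin n))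
  ... | inj₁ max≡0 = ⊥-elim (<-irrefl (sym max≡0) (≤-<-trans z≤n t<max))
  ... | inj₂ max∈ with j₀ , _ , max≡ ← ∈-map⁻ (A i) max∈
                  with j , a≡ ← row-downward (suc t) (s≤s z≤n) (subst (suc t ≤_) max≡ t<max) =
    find-complete (λ j → A i j ≟ℕ suc t) (∈-allFin j) a≡

  children′ : Fin n → List (Fin n)
  children′ i = mapMaybe (columnWith i) (applyUpTo suc (rowMax i))

  children′-image : ∀ i → map (A i) (children′ i) ≡ applyUpTo suc (rowMax i)
  children′-image i = map-mapMaybe (A i) (columnWith i) _ (columnWith-complete i)

  pos-children′ : ∀ i j → pos j (children′ i) ≡ A i j
  pos-children′ i = pos-enumeration (A i) (rowMax i) (children′-image i) row-injective
                      (λ j → ≤-maximum _ (∈-map⁺ (A i) (∈-allFin j)))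

  child⇒< : ∀ {i j} → j ∈ children′ i → toℕ i < toℕ j
  child⇒< {i} {j} j∈ with p , pos≡ , _ ← ∈⇒pos≡suc (children′ i) j∈ =
    entry>0⇒< (subst (0 <_) (trans (sym pos≡) (pos-children′ i j)) (s≤s z≤n))

  sources : List (Fin n)
  sources = filterᵇ (λ v → b A v ≡ᵇ 0) (allFin n)

  ∈-sources⁺ : ∀ {v} → b A v ≡ 0 → v ∈ sources
  ∈-sources⁺ b≡0 = ∈-filterᵇ⁺ _ (∈-allFin _) (≡⇒≡ᵇ _ 0 b≡0)

  ∈-sources⇔ : ∀ v → v ∈ sources ⇔ (∀ u → v ∉ children′ u)
  ∈-sources⇔ v = mk⇔ no-parent has-no-parent
    where
    no-parent : v ∈ sources → ∀ u → v ∉ children′ u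
    no-parent v∈ u v∈children with _ , pos≡ , _ ← ∈⇒pos≡suc (children′ u) v∈children =
      0≢1+n (trans (sym (b≡0⇒entry≡0 A (≡ᵇ⇒≡ _ 0 (proj₂ (∈-filterᵇ⁻ _ (allFin n) v∈))) u))
                   (trans (sym (pos-children′ u v)) pos≡))
    has-no-parent : (∀ u → v ∉ children′ u) → v ∈ sources
    has-no-parent orphan with b-attained A v
    ... | inj₁ b≡0           = ∈-sources⁺ b≡0
    ... | inj₂ (i , _ , 0<a) =
      ⊥-elim (orphan i (pos>0⇒∈ (children′ i) (subst (0 <_) (sym (pos-children′ i v)) 0<a)))

  sources-increasing : AllPairs (λ u v → toℕ u < toℕ v) sources
  sources-increasing = AllPairsₚ.filter⁺ _ (AllPairsₚ.tabulate⁺-< (λ i<j → i<j))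

  realisation : DOAG n
  realisation = record
    { children        = children′
    ; children-unique = λ i → enumeration-unique (rowMax i) (children′-image i)
    ; acyclic         = λ v v⁺v → <-irrefl refl (toℕ-increasing v⁺v)
    ; srcOrder        = sources
    ; srcOrder-unique = Uniqueₚ.filter⁺ _ (Uniqueₚ.allFin⁺ n)
    ; srcOrder-spec   = ∈-sources⇔
    }
    where
    toℕ-increasing : ∀ {u w} → TransClosure (λ u w → w ∈ children′ u) u w → toℕ u < toℕ w
    toℕ-increasing [ e ]     = child⇒< e
    toℕ-increasing (e ∷ e⁺) = <-trans (child⇒< e) (toℕ-increasing e⁺)

module _ {A : Matrix n} (c1 : Cond1 A) (c2 : Cond2 A) where

  private
    increasing-by : ∀ d {i j x} → toℕ x ≡ suc (d + toℕ j) →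
                    b A j ≡ suc (toℕ i) → b A x ≡ suc (toℕ i) → A i j < A i x
    increasing-by zero    {i} {j} {x} x≡ bj bx = c2 i j x x≡ bj bx
    increasing-by (suc d) {i} {j} {x} x≡ bj bx =
      <-trans (c2 i j y toℕ-y bj by) (increasing-by d x≡′ by bx)
      where
      y<x : suc (toℕ j) < toℕ x
      y<x = subst (suc (toℕ j) <_) (sym x≡) (s≤s (s≤s (m≤n+m (toℕ j) d)))
      y<n : suc (toℕ j) < n
      y<n = <-trans y<x (toℕ<n x)
      y : Fin n
      y = fromℕ< y<n
      toℕ-y : toℕ y ≡ suc (toℕ j)
      toℕ-y = toℕ-fromℕ< y<n
      x≡′ : toℕ x ≡ suc (d + toℕ y)
      x≡′ = trans x≡ (cong suc (trans (sym (+-suc d _)) (cong (d +_) (sym toℕ-y))))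
      by : b A y ≡ suc (toℕ i)
      by = ≤-antisym (subst (b A y ≤_) bx (c1 y x (subst (_≤ toℕ x) (sym toℕ-y) (<⇒≤ y<x))))
                     (subst (_≤ b A y) bj (c1 j y (subst (toℕ j ≤_) (sym toℕ-y) (n≤1+n _))))

  -- Iterating (ii) across a run of columns on which b is constant, as (i) forces it to be in between.
  increasing-within-level : ∀ {i j x} → toℕ j < toℕ x →
                            b A j ≡ suc (toℕ i) → b A x ≡ suc (toℕ i) → A i j < A i x
  increasing-within-level {j = j} {x} j<x with d , j+d≡ ← m≤n⇒∃[o]m+o≡n j<x =
    increasing-by d (trans (sym j+d≡) (cong suc (+-comm (toℕ j) d)))

module _ (A : Matrix n) (isVM : IsVariationMatrix A) (c1 : Cond1 A) (c2 : Cond2 A) where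
  open Construction A isVM
  open Decomposition realisation

  private
    upper : ∀ i j → toℕ j ≤ toℕ i → A i j ≡ 0
    upper = proj₁ isVM

    ltm-realisation : ∀ i j → ltm realisation i j ≡ A (σ i) (σ j)
    ltm-realisation i j = pos-children′ (σ i) (σ j)

  module _ {j : Fin n} (fixed : ∀ j′ → toℕ j′ < toℕ j → σ j′ ≡ j′) where

    private
      σ-fixed : ∀ i → toℕ (σ i) < toℕ j → σ i ≡ i
      σ-fixed i σi<j = σ-injective (fixed (σ i) σi<j)

      ≢∧≮⇒> : ∀ {k} → k ≢ j → (toℕ k < toℕ j → ⊥) → toℕ j < toℕ k
      ≢∧≮⇒> {k} k≢j k≮j with <-cmp (toℕ k) (toℕ j)
      ... | tri< k<j _ _ = ⊥-elim (k≮j k<j)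
      ... | tri≈ _ k≡j _ = ⊥-elim (k≢j (toℕ-injective k≡j))
      ... | tri> _ _ j<k = j<k

      column-σ⁻¹ : ∀ i → ltm realisation i (σ⁻¹ j) ≡ A i j
      column-σ⁻¹ i with toℕ (σ i) <? toℕ j
      ... | yes σi<j = trans (ltm-realisation i (σ⁻¹ j)) (cong₂ A (σ-fixed i σi<j) (σ-σ⁻¹ j))
      ... | no  σi≮j = begin
        ltm realisation i (σ⁻¹ j) ≡⟨ ltm-realisation i (σ⁻¹ j) ⟩
        A (σ i) (σ (σ⁻¹ j))       ≡⟨ cong (A (σ i)) (σ-σ⁻¹ j) ⟩
        A (σ i) j                 ≡⟨ upper (σ i) j (≮⇒≥ σi≮j) ⟩
        0                         ≡⟨ upper i j (≮⇒≥ i≮j) ⟨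
        A i j                     ∎
        where
        open ≡-Reasoning
        i≮j : ¬ toℕ i < toℕ j
        i≮j i<j = σi≮j (subst (λ z → toℕ z < toℕ j) (sym (fixed i i<j)) i<j)

      column-j : ∀ i → ltm realisation i j ≡ A i (σ j)
      column-j i with toℕ i <? toℕ j
      ... | yes i<j = trans (ltm-realisation i j) (cong (λ z → A z (σ j)) (fixed i i<j))
      ... | no  i≮j = trans (n≤0⇒n≡0 (≮⇒≥ (i≮j ∘ ltm>0⇒<))) (sym (n≤0⇒n≡0 (≮⇒≥ (i≮j ∘ parent⇒<))))
        where
        -- a parent i of σ j in A is the vertex labelled σ⁻¹ i, which precedes j and is hence fixed
        parent⇒< : 0 < A i (σ j) → toℕ i < toℕ j
        parent⇒< 0<a = subst (λ z → toℕ z < toℕ j) (trans (sym (fixed (σ⁻¹ i) q<j)) (σ-σ⁻¹ i)) q<j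
          where
          q<j : toℕ (σ⁻¹ i) < toℕ j
          q<j = ltm>0⇒< (subst (0 <_) (sym (trans (ltm-realisation (σ⁻¹ i) j) (cong (λ z → A z (σ j)) (σ-σ⁻¹ i))))
                                     0<a)

    -- Otherwise σ j is removed before j although j < σ j, and conditions (i), (ii) and the order
    -- of the sources all put j first.
    σ-step : σ j ≡ j
    σ-step with σ j ≟ j
    ... | yes σj≡j = σj≡j
    ... | no  σj≢j = ⊥-elim (impossible (subst (Precedes (σ j)) (σ-σ⁻¹ j) (σ-precedes j<σ⁻¹j)))
      where
      level-σj : level (σ j) ≡ b A (σ j)
      level-σj = trans (level-σ j) (b-cong (ltm realisation) A column-j)
      level-j : level j ≡ b A j
      level-j = b-cong (ltm realisation) A column-σ⁻¹
      j<σj : toℕ j < toℕ (σ j)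
      j<σj = ≢∧≮⇒> σj≢j λ σj<j → σj≢j (σ-injective (fixed (σ j) σj<j))
      j<σ⁻¹j : toℕ j < toℕ (σ⁻¹ j)
      j<σ⁻¹j = ≢∧≮⇒> (σj≢j ∘ σ-fixes-j) (λ σ⁻¹j<j → σj≢j (σ-fixes-j (trans (sym (fixed _ σ⁻¹j<j)) (σ-σ⁻¹ j))))
        where
        σ-fixes-j : σ⁻¹ j ≡ j → σ j ≡ j
        σ-fixes-j eq = trans (cong σ (sym eq)) (σ-σ⁻¹ j)
      impossible : Precedes (σ j) j → ⊥
      impossible (inj₁ later) = <⇒≱ (subst₂ _<_ level-σj level-j later) (c1 j (σ j) (<⇒≤ j<σj))
      impossible (inj₂ (same , by-sources , by-parent)) with b-attained A j
      ... | inj₁ b≡0 =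
        <-asym j<σj (AllPairs⇒pos< sources-increasing (∈-sources⁺ bσj≡0) (∈-sources⁺ b≡0)
                                   (by-sources (trans level-σj bσj≡0)))
        where
        bσj≡0 = trans (sym level-σj) (trans same (trans level-j b≡0))
      ... | inj₂ (i , b≡ , _) =
        <-asym (increasing-within-level c1 c2 j<σj b≡ bσj≡)
               (subst₂ _<_ (trans (cong (ltm realisation i) (σ⁻¹-σ j)) (column-j i)) (column-σ⁻¹ i)
                       (by-parent i (trans level-σj bσj≡)))
        where
        bσj≡ = trans (sym level-σj) (trans same (trans level-j b≡))

  σ-id : ∀ j → σ j ≡ j
  σ-id j = below (suc (toℕ j)) ≤-refl
    where
    below : ∀ m {j} → toℕ j < m → σ j ≡ j
    below (suc m) {j} j<1+m = σ-step (λ j′ j′<j → below m (≤-trans j′<j (≤-pred j<1+m)))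

  conditions⇒isLTM : IsLTM A
  conditions⇒isLTM = realisation , λ i j → trans (ltm-realisation i j) (cong₂ A (σ-id i) (σ-id j))

theorem4p4 : ((n : ℕ) (D : DOAG n) → IsVariationMatrix (ltm D)) ×
               ((n : ℕ) (A : Matrix n) → IsVariationMatrix A →
                 (IsLTM A ⇔ (Cond1 A × Cond2 A)))
theorem4p4 = (λ _ → ltm-isVariationMatrix)
           , λ _ A isVM → mk⇔ isLTM⇒conditions (λ (c1 , c2) → conditions⇒isLTM A isVM c1 c2)
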